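{- For $k\ge 4$, the fan $F_k$ has weight $w(F_k)=\frac{k+1}{4}$.
   Context: The fan $F_k$ is the path $P_k$ on $k$ vertices together with an additional vertex adjacent to every vertex of the path. A pebbling distribution assigns to each vertex $v$ a non-negative integer $D(v)$ of pebbles; a rooted distribution fixes a root $r$. A pebbling step $[a,b]$, for adjacent $a,b$, removes two pebbles from $a$ and adds one to $b$. A rooted distribution is $r$-solvable if some sequence of pebbling steps ends with at least one pebble on $r$; it is $r$-critical if it is $r$-solvable but removing any single pebble makes it not $r$-solvable. $c_r(G)$ is the largest size of an $r$-critical rooted distribution on $G$ over all roots; an $r$-ceiling distribution is an $r$-critical rooted distribution with exactly $c_r(G)$ pebbles. The weight of a rooted distribution is $w(D)=\sum_v D(v)/2^{d(v,r)}$ ($d$ = graph distance), and $w(G)$ is the largest weight of an $r$-ceiling distribution on $G$. -}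

module Defs where

open import Data.Bool using (Bool; true; false; _∧_; _∨_; if_then_else_)
open import Data.Nat using (ℕ; zero; suc; _+_; _∸_; _^_; _≤_; _<ᵇ_; _≡ᵇ_)
open import Data.Nat.Properties using (m^n≢0)
open import Data.Fin using (Fin; toℕ; _≟_)
open import Data.List using (List; map; foldr; allFin)
open import Data.Bool.ListAction using (any)
open import Data.Integer using (+_)
open import Data.Rational using (ℚ; 0ℚ; _/_)
import Data.Rational as Q
open import Data.Product using (Σ; _×_; ∃)
open import Relation.Nullary using (¬_; does)
open import Relation.Binary.PropositionalEquality using (_≡_)

record Graph : Set where
  field
    n   : ℕ
    adj : Fin n → Fin n → Bool
open Graph public

Vertex : Graph → Set
Vertex G = Fin (n G)

-- Fan F_k: vertices 0 .. k-1 form the path P_k (i ~ i+1), vertex k is the hub.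
fan : ℕ → Graph
fan k = record { n = suc k ; adj = a }
  where
  a : Fin (suc k) → Fin (suc k) → Bool
  a u v =
    ((toℕ u ≡ᵇ k) ∧ (toℕ v <ᵇ k))
    ∨ ((toℕ v ≡ᵇ k) ∧ (toℕ u <ᵇ k))
    ∨ ((toℕ u <ᵇ k) ∧ (toℕ v <ᵇ k)
        ∧ ((suc (toℕ u) ≡ᵇ toℕ v) ∨ (suc (toℕ v) ≡ᵇ toℕ u)))

reachWithin : (G : Graph) → ℕ → Vertex G → Vertex G → Bool
reachWithin G zero    u v = does (u ≟ v)
reachWithin G (suc m) u v =
  reachWithin G m u v ∨ any (λ w → adj G u w ∧ reachWithin G m w v) (allFin (n G))

firstTrue : (ℕ → Bool) → ℕ → ℕ → ℕ
firstTrue p m zero    = m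
firstTrue p m (suc f) = if p m then m else firstTrue p (suc m) f

dist : (G : Graph) → Vertex G → Vertex G → ℕ
dist G u v = firstTrue (λ m → reachWithin G m u v) 0 (n G)

Distribution : Graph → Set
Distribution G = Vertex G → ℕ

step : (G : Graph) → Vertex G → Vertex G → Distribution G → Distribution G
step G a b D v =
  (D v ∸ (if does (v ≟ a) then 2 else 0)) + (if does (v ≟ b) then 1 else 0)

removeOne : (G : Graph) → Vertex G → Distribution G → Distribution G
removeOne G u D v = D v ∸ (if does (v ≟ u) then 1 else 0)

data Solvable (G : Graph) (r : Vertex G) : Distribution G → Set where
  done : ∀ {D} → 1 ≤ D r → Solvable G r D
  move : ∀ {D} (a b : Vertex G) → adj G a b ≡ true → 2 ≤ D a →
         Solvable G r (step G a b D) → Solvable G r D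

Critical : (G : Graph) → Vertex G → Distribution G → Set
Critical G r D =
  Solvable G r D × (∀ u → 1 ≤ D u → ¬ Solvable G r (removeOne G u D))

size : (G : Graph) → Distribution G → ℕ
size G D = foldr _+_ 0 (map D (allFin (n G)))

IsCr : Graph → ℕ → Set
IsCr G c =
  (Σ (Vertex G) λ r → Σ (Distribution G) λ D → Critical G r D × size G D ≡ c)
  × (∀ r D → Critical G r D → size G D ≤ c)

Ceiling : (G : Graph) → ℕ → Vertex G → Distribution G → Set
Ceiling G c r D = Critical G r D × size G D ≡ c

weight : (G : Graph) → Vertex G → Distribution G → ℚ
weight G r D =
  foldr Q._+_ 0ℚ
    (map (λ v → _/_ (+ D v) (2 ^ dist G v r) {{m^n≢0 2 (dist G v r)}})
         (allFin (n G)))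

IsW : (G : Graph) → ℕ → ℚ → Set
IsW G c w =
  (Σ (Vertex G) λ r → Σ (Distribution G) λ D → Ceiling G c r D × weight G r D ≡ w)
  × (∀ r D → Ceiling G c r D → weight G r D Q.≤ w)

-- A critical distribution on F_k either carries at most three pebbles, or (by a case analysis on where
-- vertices with at least two pebbles can sit) it leaves the root empty, puts at most one pebble on the
-- neighbourhood of the root and has at most k pebbles.  Pebbles at distance two or more weigh at most
-- 1/4, so such a distribution weighs at most (k + 1)/4.  The bound is attained with the root at one end
-- of the path, two pebbles at the other end and one pebble on each vertex in between: removing an inner
-- pebble leaves a gap the stack cannot cross, and the weight is 1/2 + (k - 1)/4.
module Submission where

open import Defs
open import Data.Nat using (ℕ; _≤_; _+_)
open import Data.Integer using (+_)
open import Data.Rational using (_/_)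
open import Data.Product using (Σ; _×_)

import Algebra.Properties.CommutativeMonoid.Sum as CommutativeMonoidSum
open import Data.Bool using (Bool; true; false; T; _∧_; _∨_; if_then_else_) renaming (_≟_ to _≟ᵇ_)
open import Data.Bool.Properties using (T-≡; T-∧; T-∨)
open import Data.Empty using (⊥; ⊥-elim)
open import Data.Fin using (Fin; _≟_; toℕ; fromℕ; fromℕ<) renaming (zero to fzero; suc to fsuc)
import Data.Fin.Properties as Fin
import Data.Integer as ℤ
import Data.Integer.Properties as ℤ
open import Data.Integer.Tactic.RingSolver using (solve-∀)
open import Data.List using (map; foldr; allFin; tabulate)
import Data.List.Properties as List
open import Data.List.Membership.Propositional.Properties using (∈-allFin)
import Data.List.Relation.Unary.Any as Any
open import Data.List.Relation.Unary.Any.Properties using (any⁺; any⁻)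
open import Data.Nat using (zero; suc; _≡ᵇ_; _<ᵇ_; _*_; _∸_; _^_; _<_; _<?_; _≤?_; z≤n; s≤s; NonZero)
import Data.Nat.Properties as ℕ
open import Data.Product using (_,_; proj₂)
import Data.Rational as ℚ
import Data.Rational.Properties as ℚ
import Data.Rational.Unnormalised as ℚᵘ
import Data.Rational.Unnormalised.Properties as ℚᵘ
open import Data.Sum using (_⊎_; inj₁; inj₂)
open import Data.Vec.Functional using (Vector)
import Data.Vec.Functional as Vector
open import Function using (Equivalence; _∘_)
open import Relation.Binary using (tri<; tri≈; tri>)
open import Relation.Binary.PropositionalEquality
open import Relation.Nullary using (¬_; Dec; does; yes; no)
open import Relation.Nullary.Decidable using (_×-dec_; _⊎-dec_; ¬?; dec-true; dec-false; toWitness; isYes≗does)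

-- Rational arithmetic

toℚᵘ-/ : ∀ a d .{{_ : NonZero d}} → ℚ.toℚᵘ (+ a / d) ℚᵘ.≃ + a ℚᵘ./ d
toℚᵘ-/ a (suc d) = ℚ.toℚᵘ-fromℚᵘ (+ a ℚᵘ./ suc d)

cross-≤⇒/≤/ : ∀ a b d e .{{_ : NonZero d}} .{{_ : NonZero e}} →
              a * e ≤ b * d → + a / d ℚ.≤ + b / e
cross-≤⇒/≤/ a b d@(suc _) e@(suc _) ae≤bd = ℚ.toℚᵘ-cancel-≤
  (ℚᵘ.≤-respˡ-≃ (ℚᵘ.≃-sym (toℚᵘ-/ a d)) (ℚᵘ.≤-respʳ-≃ (ℚᵘ.≃-sym (toℚᵘ-/ b e))
    (ℚᵘ.*≤* (subst₂ ℤ._≤_ (ℤ.pos-* a e) (ℤ.pos-* b d) (ℤ.+≤+ ae≤bd)))))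

cross-≡⇒/≡/ : ∀ a b d e .{{_ : NonZero d}} .{{_ : NonZero e}} →
              a * e ≡ b * d → + a / d ≡ + b / e
cross-≡⇒/≡/ a b d e ae≡bd = ℚ.≤-antisym
  (cross-≤⇒/≤/ a b d e (ℕ.≤-reflexive ae≡bd)) (cross-≤⇒/≤/ b a e d (ℕ.≤-reflexive (sym ae≡bd)))

/-+-/ : ∀ a b d .{{_ : NonZero d}} → + a / d ℚ.+ + b / d ≡ + (a + b) / d
/-+-/ a b d@(suc _) = ℚ.toℚᵘ-injective
  (ℚᵘ.≃-trans (ℚ.toℚᵘ-homo-+ (+ a / d) (+ b / d))
  (ℚᵘ.≃-trans (ℚᵘ.+-cong (toℚᵘ-/ a d) (toℚᵘ-/ b d))
  (ℚᵘ.≃-trans (ℚᵘ.*≡* cross) (ℚᵘ.≃-sym (toℚᵘ-/ (a + b) d)))))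
  where
  distrib : ∀ x y z → (x ℤ.* z ℤ.+ y ℤ.* z) ℤ.* z ≡ (x ℤ.+ y) ℤ.* (z ℤ.* z)
  distrib = solve-∀
  cross : (+ a ℤ.* + d ℤ.+ + b ℤ.* + d) ℤ.* + d ≡ + (a + b) ℤ.* (+ d ℤ.* + d)
  cross = trans (distrib (+ a) (+ b) (+ d)) (cong (ℤ._* (+ d ℤ.* + d)) (sym (ℤ.pos-+ a b)))

-- Finite sums

module Σℕ = CommutativeMonoidSum ℕ.+-0-commutativeMonoid
module Σℚ = CommutativeMonoidSum ℚ.+-0-commutativeMonoid

foldr-allFin : ∀ {A : Set} (_∙_ : A → A → A) (ε : A) {n} (f : Vector A n) →
               foldr _∙_ ε (map f (allFin n)) ≡ Vector.foldr _∙_ ε f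
foldr-allFin _∙_ ε {n} f = trans (cong (foldr _∙_ ε) (List.map-tabulate (λ i → i) f)) (go n f)
  where
  go : ∀ n (f : Vector _ n) → foldr _∙_ ε (tabulate f) ≡ Vector.foldr _∙_ ε f
  go zero    f = refl
  go (suc n) f = cong (f fzero ∙_) (go n (λ i → f (fsuc i)))

foldr-mono : ∀ {A : Set} (_≤ₐ_ : A → A → Set) {_∙_ : A → A → A} {ε : A} → ε ≤ₐ ε →
             (∀ {a b c d} → a ≤ₐ b → c ≤ₐ d → (a ∙ c) ≤ₐ (b ∙ d)) →
             ∀ {n} {f g : Vector A n} → (∀ i → f i ≤ₐ g i) →
             Vector.foldr _∙_ ε f ≤ₐ Vector.foldr _∙_ ε g
foldr-mono _≤ₐ_ ε≤ε ∙-mono {zero}  f≤g = ε≤ε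
foldr-mono _≤ₐ_ ε≤ε ∙-mono {suc n} f≤g =
  ∙-mono (f≤g fzero) (foldr-mono _≤ₐ_ ε≤ε ∙-mono (λ i → f≤g (fsuc i)))

sum-mono-≤ : ∀ {n} {f g : Vector ℕ n} → (∀ i → f i ≤ g i) → Σℕ.sum f ≤ Σℕ.sum g
sum-mono-≤ = foldr-mono _≤_ ℕ.≤-refl ℕ.+-mono-≤

sumℚ-mono-≤ : ∀ {n} {f g : Vector ℚ.ℚ n} → (∀ i → f i ℚ.≤ g i) → Σℚ.sum f ℚ.≤ Σℚ.sum g
sumℚ-mono-≤ = foldr-mono ℚ._≤_ ℚ.≤-refl ℚ.+-mono-≤

sum-/ : ∀ {n} (c : Vector ℕ n) d .{{_ : NonZero d}} → Σℚ.sum (λ i → + c i / d) ≡ + Σℕ.sum c / d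
sum-/ {zero}  c d = sym (ℚ.0/n≡0 d)
sum-/ {suc n} c d = trans (cong (+ c fzero / d ℚ.+_) (sum-/ (λ i → c (fsuc i)) d)) (/-+-/ (c fzero) _ d)

sum-const-1 : ∀ n → Σℕ.sum {n} (λ _ → 1) ≡ n
sum-const-1 zero    = refl
sum-const-1 (suc n) = cong suc (sum-const-1 n)

_↦_ : ∀ {n} → Fin n → ℕ → Vector ℕ n
(x ↦ a) v = if does (v ≟ x) then a else 0

↦-at : ∀ {n} (x : Fin n) a → (x ↦ a) x ≡ a
↦-at x a rewrite dec-true (x ≟ x) refl = refl

↦-off : ∀ {n} {x v : Fin n} a → v ≢ x → (x ↦ a) v ≡ 0
↦-off {x = x} {v} a v≢x rewrite dec-false (v ≟ x) v≢x = refl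

sum-↦ : ∀ {n} (x : Fin n) a → Σℕ.sum (x ↦ a) ≡ a
sum-↦ {suc n} fzero    a =
  trans (cong (_+_ a) (trans (Σℕ.sum-cong-≗ {n} (λ _ → refl)) (Σℕ.sum-replicate-zero n))) (ℕ.+-identityʳ a)
sum-↦ {suc n} (fsuc x) a = sum-↦ x a

sum-≤-↦ : ∀ {n} {D : Vector ℕ n} {x a} → D x ≤ a → (∀ v → v ≢ x → D v ≡ 0) → Σℕ.sum D ≤ a
sum-≤-↦ {D = D} {x} {a} Dx≤a empty = subst (Σℕ.sum D ≤_) (sum-↦ x a) (sum-mono-≤ pointwise)
  where
  pointwise : ∀ v → D v ≤ (x ↦ a) v
  pointwise v = by-cases (v ≟ x)
    where
    by-cases : Dec (v ≡ x) → D v ≤ (x ↦ a) v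
    by-cases (yes refl) rewrite ↦-at v a = Dx≤a
    by-cases (no v≢x)   rewrite empty v v≢x = z≤n

sum-≤-↦₂ : ∀ {n} {D : Vector ℕ n} {x y a b} → D x ≤ a → D y ≤ b →
           (∀ v → v ≢ x → v ≢ y → D v ≡ 0) → Σℕ.sum D ≤ a + b
sum-≤-↦₂ {D = D} {x} {y} {a} {b} Dx≤a Dy≤b empty =
  subst (Σℕ.sum D ≤_) (trans (Σℕ.∑-distrib-+ (x ↦ a) (y ↦ b)) (cong₂ _+_ (sum-↦ x a) (sum-↦ y b)))
        (sum-mono-≤ pointwise)
  where
  pointwise : ∀ v → D v ≤ (x ↦ a) v + (y ↦ b) v
  pointwise v = by-cases (v ≟ x) (v ≟ y)
    where
    by-cases : Dec (v ≡ x) → Dec (v ≡ y) → D v ≤ (x ↦ a) v + (y ↦ b) v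
    by-cases (yes refl) _          rewrite ↦-at v a = ℕ.≤-trans Dx≤a (ℕ.m≤m+n a _)
    by-cases (no v≢x)   (yes refl) rewrite ↦-at v b = ℕ.≤-trans Dy≤b (ℕ.m≤n+m b _)
    by-cases (no v≢x)   (no v≢y)   rewrite empty v v≢x v≢y = z≤n

sum-+↦+↦ : ∀ {n} (D : Vector ℕ n) x y →
           Σℕ.sum (λ v → D v + (x ↦ 1) v + (y ↦ 1) v) ≡ Σℕ.sum D + 1 + 1
sum-+↦+↦ D x y = trans (Σℕ.∑-distrib-+ (λ v → D v + (x ↦ 1) v) (y ↦ 1))
  (cong₂ _+_ (trans (Σℕ.∑-distrib-+ D (x ↦ 1)) (cong (_+_ (Σℕ.sum D)) (sum-↦ x 1))) (sum-↦ y 1))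

sum-1+↦ : ∀ {n} (m : Fin n) → Σℕ.sum (λ v → 1 + (m ↦ 1) v) ≡ n + 1
sum-1+↦ {n} m = trans (Σℕ.∑-distrib-+ (λ _ → 1) (m ↦ 1)) (cong₂ _+_ (sum-const-1 n) (sum-↦ m 1))

-- Compare D + (x ↦ 1) + (y ↦ 1) with 1 + (m ↦ 1) pointwise.
sum-≤-pred : ∀ {k} {D : Vector ℕ (suc k)} {x y m} → x ≢ y → D x ≡ 0 → D y ≡ 0 → D m ≤ 2 →
             (∀ v → v ≢ m → D v ≤ 1) → Σℕ.sum D ≤ k
sum-≤-pred {k} {D} {x} {y} {m} x≢y Dx≡0 Dy≡0 Dm≤2 ≤1 =
  ℕ.+-cancelʳ-≤ 1 _ k (subst (Σℕ.sum D + 1 ≤_) (ℕ.+-comm 1 k) (ℕ.+-cancelʳ-≤ 1 _ _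
    (subst₂ _≤_ (sum-+↦+↦ D x y) (sum-1+↦ m) (sum-mono-≤ pointwise))))
  where
  pointwise : ∀ v → D v + (x ↦ 1) v + (y ↦ 1) v ≤ 1 + (m ↦ 1) v
  pointwise v = by-cases (v ≟ x) (v ≟ y) (v ≟ m)
    where
    by-cases : Dec (v ≡ x) → Dec (v ≡ y) → Dec (v ≡ m) → D v + (x ↦ 1) v + (y ↦ 1) v ≤ 1 + (m ↦ 1) v
    by-cases (yes refl) _          _
      rewrite Dx≡0 | ↦-at v 1 | ↦-off {x = y} 1 x≢y = s≤s z≤n
    by-cases (no v≢x)   (yes refl) _
      rewrite Dy≡0 | ↦-off {x = x} 1 v≢x | ↦-at v 1 = s≤s z≤n
    by-cases (no v≢x)   (no v≢y)   (yes refl)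
      rewrite ↦-off {x = x} 1 v≢x | ↦-off {x = y} 1 v≢y | ↦-at v 1
            | ℕ.+-identityʳ (D v) | ℕ.+-identityʳ (D v) = Dm≤2
    by-cases (no v≢x)   (no v≢y)   (no v≢m)
      rewrite ↦-off {x = x} 1 v≢x | ↦-off {x = y} 1 v≢y | ↦-off {x = m} 1 v≢m
            | ℕ.+-identityʳ (D v) | ℕ.+-identityʳ (D v) = ≤1 v v≢m

-- Distances

firstTrue-≥ : ∀ (p : ℕ → Bool) {j m} f → (∀ {i} → i < m → ¬ T (p i)) → m ≤ j + f →
              m ≤ firstTrue p j f
firstTrue-≥ p {j} zero    _     m≤j+0 = subst (_ ≤_) (ℕ.+-identityʳ j) m≤j+0
firstTrue-≥ p {j} {m} (suc f) below m≤j+f with p j in pj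
... | true  = ℕ.≮⇒≥ (λ j<m → below j<m (subst T (sym pj) _))
... | false = firstTrue-≥ p f below (subst (m ≤_) (ℕ.+-suc j f) m≤j+f)

firstTrue-≤ : ∀ (p : ℕ → Bool) {j m} f → T (p m) → j ≤ m → m < j + f → firstTrue p j f ≤ m
firstTrue-≤ p {j} {m} zero    _  j≤m m<j+0 =
  ⊥-elim (ℕ.<-irrefl refl (ℕ.<-≤-trans (subst (m <_) (ℕ.+-identityʳ j) m<j+0) j≤m))
firstTrue-≤ p {j} {m} (suc f) pm j≤m m<j+f with p j in pj
... | true  = j≤m
... | false = firstTrue-≤ p f pm (ℕ.≤∧≢⇒< j≤m j≢m) (subst (m <_) (ℕ.+-suc j f) m<j+f)
  where
  j≢m : j ≢ m
  j≢m refl = subst T pj pm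

module Distance (G : Graph) where

  reachWithin-refl : ∀ v → T (reachWithin G 0 v v)
  reachWithin-refl v = subst T (sym (dec-true (v ≟ v) refl)) _

  ¬reachWithin-0 : ∀ {u v} → u ≢ v → ¬ T (reachWithin G 0 u v)
  ¬reachWithin-0 u≢v t = subst T (dec-false (_ ≟ _) u≢v) t

  reachWithin-suc : ∀ {m u w v} → adj G u w ≡ true → T (reachWithin G m w v) → T (reachWithin G (suc m) u v)
  reachWithin-suc {m} {u} {w} {v} uw reach = Equivalence.from T-∨ (inj₂ (any⁺ _ (Any.map first (∈-allFin w))))
    where
    first : ∀ {x} → w ≡ x → T (adj G u x ∧ reachWithin G m x v)
    first refl = Equivalence.from T-∧ (Equivalence.from T-≡ uw , reach)

  ¬reachWithin-1 : ∀ {u v} → u ≢ v → adj G u v ≢ true → ¬ T (reachWithin G 1 u v)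
  ¬reachWithin-1 {u} {v} u≢v ¬uv t with Equivalence.to T-∨ t
  ... | inj₁ t₀ = ¬reachWithin-0 u≢v t₀
  ... | inj₂ t₁ with Any.satisfied (any⁻ _ (allFin (n G)) t₁)
  ...   | w , uw∧w≡v with Equivalence.to T-∧ uw∧w≡v
  ...     | uw , w≡v = ¬uv (subst (λ x → adj G u x ≡ true) (toWitness (subst T (sym (isYes≗does (w ≟ v))) w≡v))
                                (Equivalence.to T-≡ uw))

  1≤dist : ∀ {u v} → 1 ≤ n G → u ≢ v → 1 ≤ dist G u v
  1≤dist 1≤n u≢v = firstTrue-≥ _ (n G) (λ { (s≤s z≤n) → ¬reachWithin-0 u≢v }) 1≤n

  2≤dist : ∀ {u v} → 2 ≤ n G → u ≢ v → adj G u v ≢ true → 2 ≤ dist G u v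
  2≤dist 2≤n u≢v ¬uv = firstTrue-≥ _ (n G) below 2≤n
    where
    below : ∀ {i} → i < 2 → ¬ T (reachWithin G i _ _)
    below (s≤s z≤n)       = ¬reachWithin-0 u≢v
    below (s≤s (s≤s z≤n)) = ¬reachWithin-1 u≢v ¬uv

  dist-adj : ∀ {u v} → 2 ≤ n G → u ≢ v → adj G u v ≡ true → dist G u v ≡ 1
  dist-adj {u} {v} 2≤n u≢v uv = ℕ.≤-antisym
    (firstTrue-≤ _ {0} {1} (n G) (reachWithin-suc {0} uv (reachWithin-refl v)) z≤n 2≤n)
    (1≤dist (ℕ.≤-trans (s≤s z≤n) 2≤n) u≢v)

  dist-common-neighbour : ∀ {u w v} → 3 ≤ n G → u ≢ v → adj G u v ≢ true →
                          adj G u w ≡ true → adj G w v ≡ true → dist G u v ≡ 2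
  dist-common-neighbour {u} {w} {v} 3≤n u≢v ¬uv uw wv = ℕ.≤-antisym
    (firstTrue-≤ _ {0} {2} (n G) (reachWithin-suc {1} uw (reachWithin-suc {0} wv (reachWithin-refl v))) z≤n 3≤n)
    (2≤dist (ℕ.≤-trans (ℕ.n≤1+n 2) 3≤n) u≢v ¬uv)

-- Pebbling

module Pebbling (G : Graph) (adj⇒≢ : ∀ {u v} → adj G u v ≡ true → u ≢ v) where

  step-source : ∀ {a b} (D : Distribution G) → a ≢ b → step G a b D a ≡ D a ∸ 2
  step-source {a} {b} D a≢b rewrite dec-true (a ≟ a) refl | dec-false (a ≟ b) a≢b = ℕ.+-identityʳ _

  step-target : ∀ {a b} (D : Distribution G) → a ≢ b → step G a b D b ≡ suc (D b)
  step-target {a} {b} D a≢b rewrite dec-false (b ≟ a) (a≢b ∘ sym) | dec-true (b ≟ b) refl = ℕ.+-comm (D b) 1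

  step-source-≥ : ∀ {a b t} (D : Distribution G) → a ≢ b → 2 + t ≤ D a → t ≤ step G a b D a
  step-source-≥ {t = t} D a≢b 2+t≤Da = subst (t ≤_) (sym (step-source D a≢b)) (ℕ.∸-monoˡ-≤ 2 2+t≤Da)

  step-target-≥ : ∀ {a b t} (D : Distribution G) → a ≢ b → t ≤ D b → suc t ≤ step G a b D b
  step-target-≥ {t = t} D a≢b t≤Db = subst (suc t ≤_) (sym (step-target D a≢b)) (s≤s t≤Db)

  step-other : ∀ {a b v} (D : Distribution G) → v ≢ a → v ≢ b → step G a b D v ≡ D v
  step-other {a} {b} {v} D v≢a v≢b rewrite dec-false (v ≟ a) v≢a | dec-false (v ≟ b) v≢b = ℕ.+-identityʳ _

  removeOne-self : ∀ u (D : Distribution G) → removeOne G u D u ≡ D u ∸ 1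
  removeOne-self u D rewrite dec-true (u ≟ u) refl = refl

  removeOne-other : ∀ {u v} (D : Distribution G) → v ≢ u → removeOne G u D v ≡ D v
  removeOne-other {u} {v} D v≢u rewrite dec-false (v ≟ u) v≢u = refl

  removeOne-≤ : ∀ u (D : Distribution G) v → removeOne G u D v ≤ D v
  removeOne-≤ u D v = ℕ.m∸n≤m (D v) (if does (v ≟ u) then 1 else 0)

  ≤-removeOne-self : ∀ {u t} {D : Distribution G} → suc t ≤ D u → t ≤ removeOne G u D u
  ≤-removeOne-self {u} {t} {D} t<Du = subst (t ≤_) (sym (removeOne-self u D)) (ℕ.∸-monoˡ-≤ 1 t<Du)

  ≤-removeOne-other : ∀ {u v t} {D : Distribution G} → v ≢ u → t ≤ D v → t ≤ removeOne G u D v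
  ≤-removeOne-other {t = t} {D} v≢u t≤Dv = subst (t ≤_) (sym (removeOne-other D v≢u)) t≤Dv

  ¬solvable-≤1 : ∀ {r} {D : Distribution G} → D r ≡ 0 → (∀ v → D v ≤ 1) → ¬ Solvable G r D
  ¬solvable-≤1 Dr≡0 _   (done 1≤Dr)          with () ← subst (1 ≤_) Dr≡0 1≤Dr
  ¬solvable-≤1 _    ≤1  (move a _ _ 2≤Da _) with s≤s () ← ℕ.≤-trans 2≤Da (≤1 a)

  neighbour-solvable : ∀ {r a} {D : Distribution G} → adj G a r ≡ true → 2 ≤ D a → Solvable G r D
  neighbour-solvable {D = D} ar 2≤Da = move _ _ ar 2≤Da (done (step-target-≥ D (adj⇒≢ ar) z≤n))

  hop-solvable : ∀ {r h v} {D : Distribution G} → adj G h r ≡ true → adj G v h ≡ true →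
                 1 ≤ D h → 2 ≤ D v → Solvable G r D
  hop-solvable {D = D} hr vh 1≤Dh 2≤Dv =
    move _ _ vh 2≤Dv (neighbour-solvable hr (step-target-≥ D (adj⇒≢ vh) 1≤Dh))

  two-hop-solvable : ∀ {r h v w} {D : Distribution G} → adj G h r ≡ true →
                     adj G v h ≡ true → adj G w h ≡ true → w ≢ v → 2 ≤ D v → 2 ≤ D w → Solvable G r D
  two-hop-solvable {D = D} hr vh wh w≢v 2≤Dv 2≤Dw = move _ _ vh 2≤Dv
    (hop-solvable hr wh (step-target-≥ D (adj⇒≢ vh) z≤n)
                        (subst (2 ≤_) (sym (step-other D w≢v (adj⇒≢ wh))) 2≤Dw))

  four-hop-solvable : ∀ {r h v} {D : Distribution G} → adj G h r ≡ true → adj G v h ≡ true → 4 ≤ D v →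
                      Solvable G r D
  four-hop-solvable {D = D} hr vh 4≤Dv = move _ _ vh (ℕ.≤-trans (ℕ.m≤n+m 2 2) 4≤Dv)
    (hop-solvable hr vh (step-target-≥ D (adj⇒≢ vh) z≤n) (step-source-≥ D (adj⇒≢ vh) 4≤Dv))

  critical-empty : ∀ {r u} {D : Distribution G} → (∀ u → 1 ≤ D u → ¬ Solvable G r (removeOne G u D)) →
                   (1 ≤ D u → Solvable G r (removeOne G u D)) → D u ≡ 0
  critical-empty {u = u} critical spare = ℕ.n≤0⇒n≡0 (ℕ.≮⇒≥ (λ 1≤Du → critical u 1≤Du (spare 1≤Du)))

  critical-cap : ∀ {r u t} {D : Distribution G} → (∀ u → 1 ≤ D u → ¬ Solvable G r (removeOne G u D)) →
                 (t ≤ removeOne G u D u → Solvable G r (removeOne G u D)) → D u ≤ t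
  critical-cap {u = u} {D = D} critical spare =
    ℕ.≮⇒≥ (λ t<Du → critical u (ℕ.≤-trans (s≤s z≤n) t<Du) (spare (≤-removeOne-self {u} {D = D} t<Du)))

-- Weight

SparseAround : (G : Graph) → Vertex G → Distribution G → Set
SparseAround G r D =
  D r ≡ 0 × Σ (Vertex G) λ x → D x ≤ 1 × (∀ v → adj G v r ≡ true → v ≢ x → D v ≡ 0)

sparse-empty-neighbours : ∀ {G r} {D : Distribution G} → D r ≡ 0 → (∀ v → adj G v r ≡ true → D v ≡ 0) →
                          SparseAround G r D
sparse-empty-neighbours {r = r} Dr≡0 empty = Dr≡0 , r , subst (_≤ 1) (sym Dr≡0) z≤n , λ v vr _ → empty v vr

_/2^_ : ℕ → ℕ → ℚ.ℚ
a /2^ d = _/_ (+ a) (2 ^ d) {{ℕ.m^n≢0 2 d}}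

size≡sum : ∀ G (D : Distribution G) → size G D ≡ Σℕ.sum D
size≡sum G D = foldr-allFin _+_ 0 D

weight≡sum : ∀ G r (D : Distribution G) → weight G r D ≡ Σℚ.sum (λ v → D v /2^ dist G v r)
weight≡sum G r D = foldr-allFin ℚ._+_ ℚ.0ℚ (λ v → D v /2^ dist G v r)

module _ {G : Graph} where
  open Distance G

  weight-≤ : ∀ {r D} → 2 ≤ n G → SparseAround G r D → weight G r D ℚ.≤ + (size G D + 1) / 4
  weight-≤ {r} {D} 2≤n (Dr≡0 , x , Dx≤1 , others) = begin
    weight G r D                               ≡⟨ weight≡sum G r D ⟩
    Σℚ.sum (λ v → D v /2^ dist G v r)          ≤⟨ sumℚ-mono-≤ quarter-≤ ⟩
    Σℚ.sum (λ v → + (D v + (x ↦ 1) v) / 4)     ≡⟨ sum-/ (λ v → D v + (x ↦ 1) v) 4 ⟩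
    + Σℕ.sum (λ v → D v + (x ↦ 1) v) / 4       ≡⟨ cong (λ s → + s / 4) total ⟩
    + (size G D + 1) / 4                       ∎
    where
    open ℚ.≤-Reasoning
    total : Σℕ.sum (λ v → D v + (x ↦ 1) v) ≡ size G D + 1
    total = trans (Σℕ.∑-distrib-+ D (x ↦ 1)) (cong₂ _+_ (sym (size≡sum G D)) (sum-↦ x 1))
    empty : ∀ {a b} → a ≡ 0 → a * 4 ≤ b
    empty refl = z≤n
    lone : ∀ {a p} → a ≤ 1 → 2 ≤ p → a * 4 ≤ (a + 1) * p
    lone {zero}  _         _   = z≤n
    lone {suc zero} _      2≤p = ℕ.*-monoʳ-≤ 2 2≤p
    lone {suc (suc _)} (s≤s ()) _
    -- A pebble at distance at least two weighs at most 1/4; the lone pebble next to r weighs 1/2,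
    -- which is charged as its own quarter plus the extra quarter from x ↦ 1.
    numerator-≤ : ∀ v → D v * 4 ≤ (D v + (x ↦ 1) v) * 2 ^ dist G v r
    numerator-≤ v with v ≟ r
    ... | yes refl = empty Dr≡0
    ... | no v≢r with adj G v r ≟ᵇ true
    ...   | no ¬vr = ℕ.≤-trans
      (ℕ.*-monoʳ-≤ (D v) (ℕ.^-monoʳ-≤ 2 {2} {dist G v r} (2≤dist 2≤n v≢r ¬vr)))
      (ℕ.*-monoˡ-≤ (2 ^ dist G v r) (ℕ.m≤m+n (D v) _))
    ...   | yes vr with v ≟ x
    ...     | yes refl =
      lone Dx≤1 (ℕ.^-monoʳ-≤ 2 {1} {dist G v r} (1≤dist (ℕ.≤-trans (ℕ.n≤1+n 1) 2≤n) v≢r))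
    ...     | no v≢x = empty (others v vr v≢x)
    quarter-≤ : ∀ v → D v /2^ dist G v r ℚ.≤ + (D v + (x ↦ 1) v) / 4
    quarter-≤ v = cross-≤⇒/≤/ (D v) (D v + (x ↦ 1) v) (2 ^ dist G v r) 4 {{ℕ.m^n≢0 2 (dist G v r)}}
                              (numerator-≤ v)

-- Positions on a path

Consecutive : ℕ → ℕ → Set
Consecutive i j = suc i ≡ j ⊎ suc j ≡ i

Between : ℕ → ℕ → ℕ → Set
Between x z y = (x < z × z < y) ⊎ (y < z × z < x)

Between? : ∀ x z y → Dec (Between x z y)
Between? x z y = ((x <? z) ×-dec (z <? y)) ⊎-dec ((y <? z) ×-dec (z <? x))

Between-≢ʳ : ∀ {x z y} → Between x z y → z ≢ y
Between-≢ʳ (inj₁ (_ , z<y)) refl = ℕ.<-irrefl refl z<y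
Between-≢ʳ (inj₂ (y<z , _)) refl = ℕ.<-irrefl refl y<z

Between-≢ˡ : ∀ {x z y} → Between x z y → z ≢ x
Between-≢ˡ (inj₁ (x<z , _)) refl = ℕ.<-irrefl refl x<z
Between-≢ˡ (inj₂ (_ , z<x)) refl = ℕ.<-irrefl refl z<x

Between-trans : ∀ {x i y z} → Between x i y → Between x z i → Between x z y
Between-trans (inj₁ (_ , i<y))   (inj₁ (x<z , z<i)) = inj₁ (x<z , ℕ.<-trans z<i i<y)
Between-trans (inj₁ (x<i , _))   (inj₂ (i<z , z<x)) = ⊥-elim (ℕ.<-asym x<i (ℕ.<-trans i<z z<x))
Between-trans (inj₂ (_ , i<x))   (inj₁ (x<z , z<i)) = ⊥-elim (ℕ.<-asym i<x (ℕ.<-trans x<z z<i))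
Between-trans (inj₂ (y<i , _))   (inj₂ (i<z , z<x)) = inj₂ (ℕ.<-trans y<i i<z , z<x)

Between⇒¬Consecutive : ∀ {x z y} → Between x z y → ¬ Consecutive y x
Between⇒¬Consecutive (inj₁ (x<z , z<y)) (inj₁ refl) = ℕ.<-asym (ℕ.<-trans x<z z<y) (ℕ.n<1+n _)
Between⇒¬Consecutive (inj₁ (x<z , z<y)) (inj₂ refl) = ℕ.<-irrefl refl (ℕ.<-≤-trans z<y x<z)
Between⇒¬Consecutive (inj₂ (y<z , z<x)) (inj₁ refl) = ℕ.<-irrefl refl (ℕ.<-≤-trans z<x y<z)
Between⇒¬Consecutive (inj₂ (y<z , z<x)) (inj₂ refl) = ℕ.<-asym (ℕ.<-trans y<z z<x) (ℕ.n<1+n _)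

Between-shift : ∀ {x z y y′} → Between x z y → Consecutive y y′ → z ≢ y′ → Between x z y′
Between-shift (inj₁ (x<z , z<y)) (inj₁ refl) _    = inj₁ (x<z , ℕ.<-trans z<y (ℕ.n<1+n _))
Between-shift (inj₁ (x<z , z<y)) (inj₂ refl) z≢y′ = inj₁ (x<z , ℕ.≤∧≢⇒< (ℕ.≤-pred z<y) z≢y′)
Between-shift (inj₂ (y<z , z<x)) (inj₁ refl) z≢y′ = inj₂ (ℕ.≤∧≢⇒< y<z (z≢y′ ∘ sym) , z<x)
Between-shift (inj₂ (y<z , z<x)) (inj₂ refl) _    = inj₂ (ℕ.<-trans (ℕ.n<1+n _) y<z , z<x)

Consecutive-Between-unique : ∀ {x y i j} → Consecutive i x → Consecutive j x →
                             Between x i y → Between x j y → i ≡ j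
Consecutive-Between-unique (inj₁ refl) (inj₁ e)    _ _ = ℕ.suc-injective (sym e)
Consecutive-Between-unique (inj₂ refl) (inj₂ refl) _ _ = refl
Consecutive-Between-unique (inj₁ refl) (inj₂ refl) (inj₁ (i<x , _)) _ = ⊥-elim (ℕ.<-asym i<x (ℕ.n<1+n _))
Consecutive-Between-unique (inj₁ refl) (inj₂ refl) (inj₂ (y<i , _)) (inj₁ (_ , j<y)) =
  ⊥-elim (ℕ.<-asym y<i (ℕ.<-trans (ℕ.n<1+n _) (ℕ.<-trans (ℕ.n<1+n _) j<y)))
Consecutive-Between-unique (inj₁ refl) (inj₂ refl) (inj₂ _) (inj₂ (_ , j<x)) =
  ⊥-elim (ℕ.<-asym j<x (ℕ.n<1+n _))
Consecutive-Between-unique (inj₂ refl) (inj₁ refl) _ (inj₁ (j<x , _)) = ⊥-elim (ℕ.<-asym j<x (ℕ.n<1+n _))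
Consecutive-Between-unique (inj₂ refl) (inj₁ refl) (inj₁ (_ , i<y)) (inj₂ (y<j , _)) =
  ⊥-elim (ℕ.<-asym y<j (ℕ.<-trans (ℕ.n<1+n _) (ℕ.<-trans (ℕ.n<1+n _) i<y)))
Consecutive-Between-unique (inj₂ refl) (inj₁ refl) (inj₂ (_ , i<x)) _ = ⊥-elim (ℕ.<-asym i<x (ℕ.n<1+n _))

-- The fan

module Fan (k : ℕ) where

  G : Graph
  G = fan k

  V : Set
  V = Vertex G

  data FanAdj (u v : V) : Set where
    hub-spine   : toℕ u ≡ k → toℕ v < k → FanAdj u v
    spine-hub   : toℕ u < k → toℕ v ≡ k → FanAdj u v
    spine-spine : toℕ u < k → toℕ v < k → Consecutive (toℕ u) (toℕ v) → FanAdj u v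

  fanAdj⁺ : ∀ {u v} → FanAdj u v → adj G u v ≡ true
  fanAdj⁺ uv = Equivalence.to T-≡ (Equivalence.from T-∨ (clauses uv))
    where
    both : ∀ {a b} → T a → T b → T (a ∧ b)
    both ta tb = Equivalence.from T-∧ (ta , tb)
    clauses : ∀ {u v} → FanAdj u v →
              T ((toℕ u ≡ᵇ k) ∧ (toℕ v <ᵇ k)) ⊎
              T (((toℕ v ≡ᵇ k) ∧ (toℕ u <ᵇ k)) ∨
                 ((toℕ u <ᵇ k) ∧ (toℕ v <ᵇ k) ∧ ((suc (toℕ u) ≡ᵇ toℕ v) ∨ (suc (toℕ v) ≡ᵇ toℕ u))))
    clauses (hub-spine u≡k v<k)   = inj₁ (both (ℕ.≡⇒≡ᵇ _ _ u≡k) (ℕ.<⇒<ᵇ v<k))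
    clauses (spine-hub u<k v≡k)   =
      inj₂ (Equivalence.from T-∨ (inj₁ (both (ℕ.≡⇒≡ᵇ _ _ v≡k) (ℕ.<⇒<ᵇ u<k))))
    clauses (spine-spine u<k v<k c) = inj₂ (Equivalence.from T-∨ (inj₂
      (both (ℕ.<⇒<ᵇ u<k) (both (ℕ.<⇒<ᵇ v<k) (Equivalence.from T-∨ (consecutive c))))))
      where
      consecutive : ∀ {i j} → Consecutive i j → T (suc i ≡ᵇ j) ⊎ T (suc j ≡ᵇ i)
      consecutive (inj₁ e) = inj₁ (ℕ.≡⇒≡ᵇ _ _ e)
      consecutive (inj₂ e) = inj₂ (ℕ.≡⇒≡ᵇ _ _ e)

  fanAdj⁻ : ∀ {u v} → adj G u v ≡ true → FanAdj u v
  fanAdj⁻ {u} {v} uv with Equivalence.to T-∨ (Equivalence.from T-≡ uv)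
  ... | inj₁ t with (u≡k , v<k) ← Equivalence.to T-∧ t =
    hub-spine (ℕ.≡ᵇ⇒≡ _ _ u≡k) (ℕ.<ᵇ⇒< _ _ v<k)
  ... | inj₂ t with Equivalence.to T-∨ t
  ...   | inj₁ t′ with (v≡k , u<k) ← Equivalence.to T-∧ t′ =
    spine-hub (ℕ.<ᵇ⇒< _ _ u<k) (ℕ.≡ᵇ⇒≡ _ _ v≡k)
  ...   | inj₂ t′ with (u<k , t″) ← Equivalence.to T-∧ t′ with (v<k , c) ← Equivalence.to T-∧ t″ =
    spine-spine (ℕ.<ᵇ⇒< _ _ u<k) (ℕ.<ᵇ⇒< _ _ v<k) (consecutive (Equivalence.to T-∨ c))
    where
    consecutive : ∀ {i j} → T (suc i ≡ᵇ j) ⊎ T (suc j ≡ᵇ i) → Consecutive i j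
    consecutive (inj₁ e) = inj₁ (ℕ.≡ᵇ⇒≡ _ _ e)
    consecutive (inj₂ e) = inj₂ (ℕ.≡ᵇ⇒≡ _ _ e)

  adj⇒≢ : ∀ {u v} → adj G u v ≡ true → u ≢ v
  adj⇒≢ {u} uv refl with fanAdj⁻ {u} {u} uv
  ... | hub-spine u≡k u<k       = ℕ.<-irrefl u≡k u<k
  ... | spine-hub u<k u≡k       = ℕ.<-irrefl u≡k u<k
  ... | spine-spine _ _ (inj₁ e) = ℕ.1+n≢n e
  ... | spine-spine _ _ (inj₂ e) = ℕ.1+n≢n e

  open Distance G
  open Pebbling G adj⇒≢

  hub : V
  hub = fromℕ k

  toℕ-hub : toℕ hub ≡ k
  toℕ-hub = Fin.toℕ-fromℕ k

  spine : ∀ i → i < k → V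
  spine i i<k = fromℕ< (ℕ.m<n⇒m<1+n i<k)

  toℕ-spine : ∀ {i} (i<k : i < k) → toℕ (spine i i<k) ≡ i
  toℕ-spine i<k = Fin.toℕ-fromℕ< (ℕ.m<n⇒m<1+n i<k)

  toℕ≡k⇒hub : ∀ {v} → toℕ v ≡ k → v ≡ hub
  toℕ≡k⇒hub v≡k = Fin.toℕ-injective (trans v≡k (sym toℕ-hub))

  spine-≢hub : ∀ {v} → toℕ v < k → v ≢ hub
  spine-≢hub v<k refl = ℕ.<-irrefl toℕ-hub v<k

  ≢hub⇒spine : ∀ {v} → v ≢ hub → toℕ v < k
  ≢hub⇒spine {v} v≢hub = ℕ.≤∧≢⇒< (ℕ.≤-pred (Fin.toℕ<n v)) (v≢hub ∘ toℕ≡k⇒hub)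

  hub-adj : ∀ {v} → toℕ v < k → adj G hub v ≡ true
  hub-adj v<k = fanAdj⁺ (hub-spine toℕ-hub v<k)

  adj-hub : ∀ {v} → toℕ v < k → adj G v hub ≡ true
  adj-hub v<k = fanAdj⁺ (spine-hub v<k toℕ-hub)

  Inside : V → V → V → Set
  Inside r z a = Between (toℕ r) (toℕ z) (toℕ a)

  Gap : V → V → ℕ → Set
  Gap r a d = suc (toℕ r + d) ≡ toℕ a ⊎ suc (toℕ a + d) ≡ toℕ r

  gap : ∀ {r a} → a ≢ r → Σ ℕ (Gap r a)
  gap {r} {a} a≢r with ℕ.<-cmp (toℕ r) (toℕ a)
  ... | tri< r<a _ _ = let (d , e) = ℕ.m≤n⇒∃[o]m+o≡n r<a in d , inj₁ e
  ... | tri≈ _ r≡a _ = ⊥-elim (a≢r (Fin.toℕ-injective (sym r≡a)))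
  ... | tri> _ _ a<r = let (d , e) = ℕ.m≤n⇒∃[o]m+o≡n a<r in d , inj₂ e

  gap-zero : ∀ {r a} → Gap r a 0 → Consecutive (toℕ a) (toℕ r)
  gap-zero {r} {a} (inj₁ e) = inj₂ (trans (cong suc (sym (ℕ.+-identityʳ (toℕ r)))) e)
  gap-zero {r} {a} (inj₂ e) = inj₁ (trans (cong suc (sym (ℕ.+-identityʳ (toℕ a)))) e)

  towards : ∀ {r a d} → toℕ r < k → toℕ a < k → Gap r a (suc d) →
            Σ V λ a′ → toℕ a′ < k × adj G a a′ ≡ true × Gap r a′ d × Inside r a′ a
  towards {r} {a} {d} r<k a<k (inj₁ e) =
    a′ , a′<k , fanAdj⁺ (spine-spine a<k a′<k (inj₂ (trans (cong suc toℕa′) e))) ,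
    inj₁ (trans (sym (ℕ.+-suc (toℕ r) d)) (sym toℕa′)) ,
    inj₁ (subst (toℕ r <_) (sym toℕa′) (ℕ.m<m+n (toℕ r) (s≤s z≤n)) ,
          subst (_< toℕ a) (sym toℕa′) (ℕ.≤-reflexive e))
    where
    i<k : toℕ r + suc d < k
    i<k = ℕ.<-trans (ℕ.≤-reflexive e) a<k
    a′ : V
    a′ = spine _ i<k
    toℕa′ : toℕ a′ ≡ toℕ r + suc d
    toℕa′ = toℕ-spine i<k
    a′<k : toℕ a′ < k
    a′<k = subst (_< k) (sym toℕa′) i<k
  towards {r} {a} {d} r<k a<k (inj₂ e) =
    a′ , a′<k , fanAdj⁺ (spine-spine a<k a′<k (inj₁ (sym toℕa′))) ,
    inj₂ (trans (cong (λ i → suc (i + d)) toℕa′) (trans (cong suc (sym (ℕ.+-suc (toℕ a) d))) e)) ,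
    inj₂ (subst (toℕ a <_) (sym toℕa′) (ℕ.n<1+n _) , subst (_< toℕ r) (sym toℕa′) i<r)
    where
    i<r : suc (toℕ a) < toℕ r
    i<r = subst (suc (toℕ a) <_) e
                (s≤s (subst (suc (toℕ a) ≤_) (sym (ℕ.+-suc (toℕ a) d)) (s≤s (ℕ.m≤m+n _ _))))
    i<k : suc (toℕ a) < k
    i<k = ℕ.<-trans i<r r<k
    a′ : V
    a′ = spine _ i<k
    toℕa′ : toℕ a′ ≡ suc (toℕ a)
    toℕa′ = toℕ-spine i<k
    a′<k : toℕ a′ < k
    a′<k = subst (_< k) (sym toℕa′) i<k

  spine-cascade : ∀ d {r a} {D : Distribution G} → toℕ r < k → toℕ a < k → Gap r a d → 2 ≤ D a →
                  (∀ z → Inside r z a → 1 ≤ D z) → Solvable G r D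
  spine-cascade zero    r<k a<k g 2≤Da _ = neighbour-solvable (fanAdj⁺ (spine-spine a<k r<k (gap-zero g))) 2≤Da
  spine-cascade (suc d) {r} {a} {D} r<k a<k g 2≤Da filled with towards r<k a<k g
  ... | a′ , a′<k , aa′ , g′ , a′-inside = move a a′ aa′ 2≤Da
    (spine-cascade d r<k a′<k g′ (step-target-≥ D (adj⇒≢ aa′) (filled a′ a′-inside)) filled′)
    where
    filled′ : ∀ z → Inside r z a′ → 1 ≤ step G a a′ D z
    filled′ z z-inside = subst (1 ≤_)
      (sym (step-other D (Between-≢ʳ z-inside-a ∘ cong toℕ) (Between-≢ʳ z-inside ∘ cong toℕ)))
      (filled z z-inside-a)
      where
      z-inside-a : Inside r z a
      z-inside-a = Between-trans a′-inside z-inside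

  spine-solvable : ∀ {r a} {D : Distribution G} → toℕ r < k → toℕ a < k → a ≢ r → 2 ≤ D a →
                   (∀ z → Inside r z a → 1 ≤ D z) → Solvable G r D
  spine-solvable r<k a<k a≢r = spine-cascade _ r<k a<k (proj₂ (gap a≢r))

  Blocked : V → Distribution G → Set
  Blocked r D = D hub ≡ 0 × Σ V λ m → 2 ≤ D m × D m ≤ 3 × (∀ v → v ≢ m → D v ≤ 1) ×
                Σ V λ z → Inside r z m × D z ≡ 0

  stuck-after-move : ∀ {r m b} {D : Distribution G} → m ≢ b → r ≢ m → r ≢ b → D r ≡ 0 → D m ≤ 3 →
                     (∀ v → v ≢ m → D v ≤ 1) → D b ≡ 0 → ¬ Solvable G r (step G m b D)
  stuck-after-move {r} {m} {b} {D} m≢b r≢m r≢b Dr≡0 Dm≤3 ≤1 Db≡0 =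
    ¬solvable-≤1 (trans (step-other D r≢m r≢b) Dr≡0) ≤1′
    where
    ≤1′ : ∀ v → step G m b D v ≤ 1
    ≤1′ v = by-cases (v ≟ m) (v ≟ b)
      where
      by-cases : Dec (v ≡ m) → Dec (v ≡ b) → step G m b D v ≤ 1
      by-cases (yes refl) _          = subst (_≤ 1) (sym (step-source D m≢b)) (ℕ.∸-monoˡ-≤ 2 Dm≤3)
      by-cases (no v≢m)   (yes refl) = subst (_≤ 1) (sym (trans (step-target D m≢b) (cong suc Db≡0))) ℕ.≤-refl
      by-cases (no v≢m)   (no v≢b)   = subst (_≤ 1) (sym (step-other D v≢m v≢b)) (≤1 v v≢m)

  -- Only the stack on m can move.  Moving it onto the hub or an empty vertex leaves at most one pebble
  -- everywhere; moving it onto an occupied spine neighbour recreates the situation one step closer to z.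
  blocked-unsolvable : ∀ {r} {D : Distribution G} → toℕ r < k → D r ≡ 0 → Blocked r D → ¬ Solvable G r D
  blocked-unsolvable _ Dr≡0 _ (done 1≤Dr) with () ← subst (1 ≤_) Dr≡0 1≤Dr
  blocked-unsolvable {r} {D} r<k Dr≡0 (Dhub≡0 , m , 2≤Dm , Dm≤3 , ≤1 , z , z-inside , Dz≡0)
                     (move a b ab 2≤Da s) with a ≟ m
  ... | no a≢m with s≤s () ← ℕ.≤-trans 2≤Da (≤1 a a≢m)
  ... | yes refl = after (fanAdj⁻ ab) s
    where
    a≢b : a ≢ b
    a≢b = adj⇒≢ ab
    r≢a : r ≢ a
    r≢a refl with () ← subst (2 ≤_) Dr≡0 2≤Dm
    after : FanAdj a b → ¬ Solvable G r (step G a b D)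
    after (hub-spine a≡k _) with () ← subst (2 ≤_) (trans (cong D (toℕ≡k⇒hub a≡k)) Dhub≡0) 2≤Dm
    after (spine-hub _ b≡k) = stuck-after-move a≢b r≢a (λ r≡b → spine-≢hub r<k (trans r≡b (toℕ≡k⇒hub b≡k)))
                                Dr≡0 Dm≤3 ≤1 (trans (cong D (toℕ≡k⇒hub b≡k)) Dhub≡0)
    after (spine-spine a<k b<k ab-consecutive) with D b in Db
    ... | zero  = stuck-after-move a≢b r≢a r≢b Dr≡0 Dm≤3 ≤1 Db
      where
      r≢b : r ≢ b
      r≢b refl = Between⇒¬Consecutive z-inside ab-consecutive
    ... | suc j = blocked-unsolvable r<k (trans (step-other D r≢a r≢b) Dr≡0)
      (trans (step-other D (spine-≢hub a<k ∘ sym) (spine-≢hub b<k ∘ sym)) Dhub≡0 , b ,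
       step-target-≥ D a≢b (subst (1 ≤_) (sym Db) (s≤s z≤n)) ,
       subst (_≤ 3) (sym (step-target D a≢b)) (s≤s (ℕ.m≤n⇒m≤1+n (≤1 b (a≢b ∘ sym)))) ,
       ≤1′ , z , Between-shift z-inside ab-consecutive (z≢b ∘ Fin.toℕ-injective) ,
       trans (step-other D z≢a z≢b) Dz≡0)
      where
      r≢b : r ≢ b
      r≢b refl with () ← trans (sym Dr≡0) Db
      z≢b : z ≢ b
      z≢b refl with () ← trans (sym Dz≡0) Db
      z≢a : z ≢ a
      z≢a = Between-≢ʳ z-inside ∘ cong toℕ
      ≤1′ : ∀ v → v ≢ b → step G a b D v ≤ 1
      ≤1′ v v≢b = by-cases (v ≟ a)
        where
        by-cases : Dec (v ≡ a) → step G a b D v ≤ 1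
        by-cases (yes refl) = subst (_≤ 1) (sym (step-source D a≢b)) (ℕ.∸-monoˡ-≤ 2 Dm≤3)
        by-cases (no v≢a)   = subst (_≤ 1) (sym (step-other D v≢a v≢b)) (≤1 v v≢a)

  data Shape (r : V) (D : Distribution G) : Set where
    tiny   : Σℕ.sum D ≤ 3 → Shape r D
    sparse : Σℕ.sum D ≤ k → SparseAround G r D → Shape r D

  module Classify (4≤k : 4 ≤ k) {r} {D : Distribution G} (solvable : Solvable G r D)
                  (critical : ∀ u → 1 ≤ D u → ¬ Solvable G r (removeOne G u D)) where

    empty : ∀ u → (1 ≤ D u → Solvable G r (removeOne G u D)) → D u ≡ 0
    empty u = critical-empty {u = u} critical

    cap : ∀ u {t} → (t ≤ removeOne G u D u → Solvable G r (removeOne G u D)) → D u ≤ t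
    cap u = critical-cap {u = u} critical

    keep : ∀ {u v t} → u ≢ v → t ≤ D v → t ≤ removeOne G u D v
    keep u≢v = ≤-removeOne-other {D = D} (u≢v ∘ sym)

    light≢heavy : ∀ {u v} → D u ≤ 1 → 2 ≤ D v → u ≢ v
    light≢heavy Du≤1 2≤Dv refl with s≤s () ← ℕ.≤-trans 2≤Dv Du≤1

    stuck : D r ≡ 0 → (∀ v → D v ≤ 1) → ⊥
    stuck Dr≡0 ≤1 = ¬solvable-≤1 Dr≡0 ≤1 solvable

    classify-single-stack : D r ≡ 0 → (∀ v → adj G v r ≡ true → D v ≤ 1) → toℕ r < k → D hub ≡ 0 →
                            ∀ m → 2 ≤ D m → D m ≤ 3 → (∀ v → v ≢ m → D v ≤ 1) → Shape r D
    classify-single-stack Dr≡0 nb≤1 r<k Dhub≡0 m 2≤Dm Dm≤3 ≤1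
      with Fin.any? (λ z → Between? (toℕ r) (toℕ z) (toℕ m) ×-dec (D z ℕ.≟ 0))
    ... | yes (z , z-inside , Dz≡0) =
      ⊥-elim (blocked-unsolvable r<k Dr≡0 (Dhub≡0 , m , 2≤Dm , Dm≤3 , ≤1 , z , z-inside , Dz≡0) solvable)
    ... | no no-gap = sparse (sum-≤-pred (spine-≢hub r<k) Dr≡0 Dhub≡0 Dm≤2 ≤1) neighbourhood
      where
      filled : ∀ z → Inside r z m → 1 ≤ D z
      filled z z-inside = ℕ.n≢0⇒n>0 (λ Dz≡0 → no-gap (z , z-inside , Dz≡0))
      m<k : toℕ m < k
      m<k = ≢hub⇒spine (light≢heavy (subst (_≤ 1) (sym Dhub≡0) z≤n) 2≤Dm ∘ sym)
      m≢r : m ≢ r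
      m≢r = light≢heavy (subst (_≤ 1) (sym Dr≡0) z≤n) 2≤Dm ∘ sym
      Dm≤2 : D m ≤ 2
      Dm≤2 = cap m (λ 2≤Dm′ → spine-solvable r<k m<k m≢r 2≤Dm′
                              (λ z z-inside → keep (Between-≢ʳ z-inside ∘ cong toℕ ∘ sym) (filled z z-inside)))
      outside-empty : ∀ u → u ≢ m → ¬ Inside r u m → D u ≡ 0
      outside-empty u u≢m outside = empty u (λ _ → spine-solvable r<k m<k m≢r (keep u≢m 2≤Dm)
        (λ z z-inside → keep (λ u≡z → outside (subst (λ t → Inside r t m) (sym u≡z) z-inside))
                             (filled z z-inside)))
      occupied-neighbour : ∀ u → adj G u r ≡ true → 1 ≤ D u → Consecutive (toℕ u) (toℕ r) × Inside r u m
      occupied-neighbour u ur 1≤Du with fanAdj⁻ ur | Between? (toℕ r) (toℕ u) (toℕ m)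
      ... | _ | no outside with () ← subst (1 ≤_) (outside-empty u (light≢heavy (nb≤1 u ur) 2≤Dm) outside) 1≤Du
      ... | hub-spine u≡k _ | yes _ with () ← subst (1 ≤_) (trans (cong D (toℕ≡k⇒hub u≡k)) Dhub≡0) 1≤Du
      ... | spine-hub _ r≡k | yes _ = ⊥-elim (ℕ.<-irrefl r≡k r<k)
      ... | spine-spine _ _ c | yes u-inside = c , u-inside
      neighbourhood : SparseAround G r D
      neighbourhood with Fin.any? (λ u → (adj G u r ≟ᵇ true) ×-dec (1 ≤? D u))
      ... | no none =
        sparse-empty-neighbours {G} Dr≡0 (λ u ur → ℕ.n≤0⇒n≡0 (ℕ.≮⇒≥ (λ 1≤Du → none (u , ur , 1≤Du))))
      ... | yes (x , xr , 1≤Dx) = Dr≡0 , x , nb≤1 x xr , only-x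
        where
        only-x : ∀ u → adj G u r ≡ true → u ≢ x → D u ≡ 0
        only-x u ur u≢x = ℕ.n≤0⇒n≡0 (ℕ.≮⇒≥ λ 1≤Du →
          let (cu , u-inside) = occupied-neighbour u ur 1≤Du
              (cx , x-inside) = occupied-neighbour x xr 1≤Dx
          in u≢x (Fin.toℕ-injective (Consecutive-Between-unique cu cx u-inside x-inside)))

    classify-below-four : D r ≡ 0 → (∀ v → adj G v r ≡ true → D v ≤ 1) → toℕ r < k → D hub ≡ 0 →
                          (∀ v → D v ≤ 3) → Shape r D
    classify-below-four Dr≡0 nb≤1 r<k Dhub≡0 ≤3 with Fin.any? (λ v → 2 ≤? D v)
    ... | no none = ⊥-elim (stuck Dr≡0 (λ v → ℕ.≮⇒≥ (λ 2≤Dv → none (v , 2≤Dv))))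
    ... | yes (v , 2≤Dv) with Fin.any? (λ w → ¬? (w ≟ v) ×-dec (2 ≤? D w))
    ...   | no none = classify-single-stack Dr≡0 nb≤1 r<k Dhub≡0 v 2≤Dv (≤3 v)
                        (λ w w≢v → ℕ.≮⇒≥ (λ 2≤Dw → none (w , w≢v , 2≤Dw)))
    ...   | yes (w , w≢v , 2≤Dw) =
      sparse (ℕ.≤-trans (sum-≤-↦₂ Dv≤2 Dw≤2 only-v-w) 4≤k)
             (sparse-empty-neighbours {G} Dr≡0 (λ u ur → only-v-w u (light≢heavy (nb≤1 u ur) 2≤Dv)
                                                                (light≢heavy (nb≤1 u ur) 2≤Dw)))
      where
      hr : adj G hub r ≡ true
      hr = hub-adj r<k
      spine-if-heavy : ∀ {u} → 2 ≤ D u → adj G u hub ≡ true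
      spine-if-heavy 2≤Du = adj-hub (≢hub⇒spine (light≢heavy (subst (_≤ 1) (sym Dhub≡0) z≤n) 2≤Du ∘ sym))
      solves : ∀ {D′ : Distribution G} → 2 ≤ D′ v → 2 ≤ D′ w → Solvable G r D′
      solves = two-hop-solvable hr (spine-if-heavy 2≤Dv) (spine-if-heavy 2≤Dw) w≢v
      Dv≤2 : D v ≤ 2
      Dv≤2 = cap v (λ 2≤Dv′ → solves 2≤Dv′ (keep (w≢v ∘ sym) 2≤Dw))
      Dw≤2 : D w ≤ 2
      Dw≤2 = cap w (λ 2≤Dw′ → solves (keep w≢v 2≤Dv) 2≤Dw′)
      only-v-w : ∀ u → u ≢ v → u ≢ w → D u ≡ 0
      only-v-w u u≢v u≢w = empty u (λ _ → solves (keep u≢v 2≤Dv) (keep u≢w 2≤Dw))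

    classify-hub-empty : D r ≡ 0 → (∀ v → adj G v r ≡ true → D v ≤ 1) → toℕ r < k → D hub ≡ 0 →
                         Shape r D
    classify-hub-empty Dr≡0 nb≤1 r<k Dhub≡0 with Fin.any? (λ v → 4 ≤? D v)
    ... | no none = classify-below-four Dr≡0 nb≤1 r<k Dhub≡0 (λ v → ℕ.≮⇒≥ (λ 4≤Dv → none (v , 4≤Dv)))
    ... | yes (v , 4≤Dv) =
      sparse (ℕ.≤-trans (sum-≤-↦ (cap v solves) only-v) 4≤k)
             (sparse-empty-neighbours {G} Dr≡0 (λ u ur → only-v u (light≢heavy (nb≤1 u ur) 2≤Dv)))
      where
      2≤Dv : 2 ≤ D v
      2≤Dv = ℕ.≤-trans (s≤s (s≤s z≤n)) 4≤Dv
      vh : adj G v hub ≡ true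
      vh = adj-hub (≢hub⇒spine (light≢heavy (subst (_≤ 1) (sym Dhub≡0) z≤n) 2≤Dv ∘ sym))
      solves : ∀ {D′ : Distribution G} → 4 ≤ D′ v → Solvable G r D′
      solves = four-hop-solvable (hub-adj r<k) vh
      only-v : ∀ u → u ≢ v → D u ≡ 0
      only-v u u≢v = empty u (λ _ → solves (keep u≢v 4≤Dv))

    classify-hub-occupied : D r ≡ 0 → (∀ v → adj G v r ≡ true → D v ≤ 1) → toℕ r < k → 1 ≤ D hub →
                            Shape r D
    classify-hub-occupied Dr≡0 nb≤1 r<k 1≤Dhub with Fin.any? (λ v → 2 ≤? D v)
    ... | no none = ⊥-elim (stuck Dr≡0 (λ v → ℕ.≮⇒≥ (λ 2≤Dv → none (v , 2≤Dv))))
    ... | yes (v , 2≤Dv) =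
      tiny (sum-≤-↦₂ (nb≤1 hub hr) (cap v (λ 2≤Dv′ → solves (keep (hub≢v ∘ sym) 1≤Dhub) 2≤Dv′)) only-hub-v)
      where
      hr : adj G hub r ≡ true
      hr = hub-adj r<k
      hub≢v : hub ≢ v
      hub≢v = light≢heavy (nb≤1 hub hr) 2≤Dv
      solves : ∀ {D′ : Distribution G} → 1 ≤ D′ hub → 2 ≤ D′ v → Solvable G r D′
      solves = hop-solvable hr (adj-hub (≢hub⇒spine (hub≢v ∘ sym)))
      only-hub-v : ∀ u → u ≢ hub → u ≢ v → D u ≡ 0
      only-hub-v u u≢hub u≢v = empty u (λ _ → solves (keep u≢hub 1≤Dhub) (keep u≢v 2≤Dv))

    classify-light-neighbours : D r ≡ 0 → (∀ v → adj G v r ≡ true → D v ≤ 1) → Shape r D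
    classify-light-neighbours Dr≡0 nb≤1 with r ≟ hub
    ... | yes r≡hub = ⊥-elim (stuck Dr≡0 all≤1)
      where
      all≤1 : ∀ v → D v ≤ 1
      all≤1 v with v ≟ r
      ... | yes refl = subst (_≤ 1) (sym Dr≡0) z≤n
      ... | no v≢r = nb≤1 v (subst (λ h → adj G v h ≡ true) (sym r≡hub)
                                   (adj-hub (≢hub⇒spine (λ v≡hub → v≢r (trans v≡hub (sym r≡hub))))))
    ... | no r≢hub with 1 ≤? D hub
    ...   | yes 1≤Dhub = classify-hub-occupied Dr≡0 nb≤1 (≢hub⇒spine r≢hub) 1≤Dhub
    ...   | no ¬1≤Dhub =
      classify-hub-empty Dr≡0 nb≤1 (≢hub⇒spine r≢hub) (ℕ.n≤0⇒n≡0 (ℕ.≮⇒≥ ¬1≤Dhub))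

    classify-root-empty : D r ≡ 0 → Shape r D
    classify-root-empty Dr≡0 with Fin.any? (λ a → (adj G a r ≟ᵇ true) ×-dec (2 ≤? D a))
    ... | no none = classify-light-neighbours Dr≡0 (λ v vr → ℕ.≮⇒≥ (λ 2≤Dv → none (v , vr , 2≤Dv)))
    ... | yes (a , ar , 2≤Da) =
      tiny (ℕ.≤-trans (sum-≤-↦ (cap a (neighbour-solvable {a = a} ar)) only-a) (ℕ.n≤1+n 2))
      where
      only-a : ∀ u → u ≢ a → D u ≡ 0
      only-a u u≢a = empty u (λ _ → neighbour-solvable {a = a} ar (keep u≢a 2≤Da))

    classify : Shape r D
    classify with D r in Dr | cap r done
    ... | zero        | _ = classify-root-empty Dr
    ... | suc zero    | _ = tiny (ℕ.≤-trans (sum-≤-↦ (ℕ.≤-reflexive Dr) only-r) (s≤s z≤n))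
      where
      only-r : ∀ u → u ≢ r → D u ≡ 0
      only-r u u≢r = empty u (λ _ → done (keep u≢r (ℕ.≤-reflexive (sym Dr))))
    ... | suc (suc _) | s≤s ()

-- The fan is F_(suc j), so m = spine j is the end of the path opposite to r₀.
module CeilingDistribution (j : ℕ) (3≤j : 3 ≤ j) where
  open Fan (suc j)
  open Distance G
  open Pebbling G adj⇒≢

  1<k : 1 < suc j
  1<k = s≤s (ℕ.≤-trans (s≤s z≤n) 3≤j)

  r₀ r₁ m : V
  r₀ = spine 0 (s≤s z≤n)
  r₁ = spine 1 1<k
  m  = spine j ℕ.≤-refl

  toℕ-r₀ : toℕ r₀ ≡ 0
  toℕ-r₀ = toℕ-spine (s≤s z≤n)

  toℕ-r₁ : toℕ r₁ ≡ 1
  toℕ-r₁ = toℕ-spine 1<k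

  toℕ-m : toℕ m ≡ j
  toℕ-m = toℕ-spine ℕ.≤-refl

  toℕ-≢ : ∀ {u v : V} {a b} → toℕ u ≡ a → toℕ v ≡ b → a ≢ b → u ≢ v
  toℕ-≢ u≡a v≡b a≢b u≡v = a≢b (trans (sym u≡a) (trans (cong toℕ u≡v) v≡b))

  r₀≢hub : r₀ ≢ hub
  r₀≢hub = toℕ-≢ toℕ-r₀ toℕ-hub (λ ())
  r₁≢r₀ : r₁ ≢ r₀
  r₁≢r₀ = toℕ-≢ toℕ-r₁ toℕ-r₀ (λ ())
  r₁≢hub : r₁ ≢ hub
  r₁≢hub = toℕ-≢ toℕ-r₁ toℕ-hub (λ 1≡k → ℕ.<-irrefl 1≡k 1<k)
  m≢r₀ : m ≢ r₀
  m≢r₀ = toℕ-≢ toℕ-m toℕ-r₀ (λ j≡0 → ℕ.<-irrefl (sym j≡0) (ℕ.≤-trans (s≤s z≤n) 3≤j))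
  m≢r₁ : m ≢ r₁
  m≢r₁ = toℕ-≢ toℕ-m toℕ-r₁ (λ j≡1 → ℕ.<-irrefl (sym j≡1) (ℕ.≤-trans (s≤s (s≤s z≤n)) 3≤j))
  m≢hub : m ≢ hub
  m≢hub = toℕ-≢ toℕ-m toℕ-hub (ℕ.1+n≢n ∘ sym)

  ceiling : Distribution G
  ceiling v = if does (v ≟ r₀) ∨ does (v ≟ hub) then 0 else if does (v ≟ m) then 2 else 1

  ceiling-r₀ : ceiling r₀ ≡ 0
  ceiling-r₀ rewrite dec-true (r₀ ≟ r₀) refl = refl

  ceiling-hub : ceiling hub ≡ 0
  ceiling-hub rewrite dec-false (hub ≟ r₀) (r₀≢hub ∘ sym) | dec-true (hub ≟ hub) refl = refl

  ceiling-m : ceiling m ≡ 2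
  ceiling-m rewrite dec-false (m ≟ r₀) m≢r₀ | dec-false (m ≟ hub) m≢hub | dec-true (m ≟ m) refl = refl

  ceiling-spine : ∀ {v} → v ≢ r₀ → v ≢ hub → v ≢ m → ceiling v ≡ 1
  ceiling-spine {v} v≢r₀ v≢hub v≢m
    rewrite dec-false (v ≟ r₀) v≢r₀ | dec-false (v ≟ hub) v≢hub | dec-false (v ≟ m) v≢m = refl

  ceiling-≤1 : ∀ v → v ≢ m → ceiling v ≤ 1
  ceiling-≤1 v v≢m = by-cases (v ≟ r₀) (v ≟ hub)
    where
    by-cases : Dec (v ≡ r₀) → Dec (v ≡ hub) → ceiling v ≤ 1
    by-cases (yes refl) _          = subst (_≤ 1) (sym ceiling-r₀) z≤n
    by-cases (no _)     (yes refl) = subst (_≤ 1) (sym ceiling-hub) z≤n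
    by-cases (no v≢r₀)  (no v≢hub) = ℕ.≤-reflexive (ceiling-spine v≢r₀ v≢hub v≢m)

  inside-ceiling : ∀ {z} → Inside r₀ z m → ceiling z ≡ 1
  inside-ceiling z-inside = ceiling-spine (Between-≢ˡ z-inside ∘ cong toℕ) (spine-≢hub (z<k z-inside))
                                          (Between-≢ʳ z-inside ∘ cong toℕ)
    where
    z<k : ∀ {z} → Inside r₀ z m → toℕ z < suc j
    z<k (inj₁ (_ , z<m)) = ℕ.<-trans z<m (subst (_< suc j) (sym toℕ-m) ℕ.≤-refl)

  ceiling-solvable : Solvable G r₀ ceiling
  ceiling-solvable = spine-solvable (s≤s z≤n) (subst (_< suc j) (sym toℕ-m) ℕ.≤-refl) m≢r₀
    (ℕ.≤-reflexive (sym ceiling-m)) (λ z z-inside → ℕ.≤-reflexive (sym (inside-ceiling z-inside)))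

  ceiling-critical-m : ¬ Solvable G r₀ (removeOne G m ceiling)
  ceiling-critical-m = ¬solvable-≤1 (trans (removeOne-other ceiling (m≢r₀ ∘ sym)) ceiling-r₀) ≤1
    where
    ≤1 : ∀ v → removeOne G m ceiling v ≤ 1
    ≤1 v = by-cases (v ≟ m)
      where
      by-cases : Dec (v ≡ m) → removeOne G m ceiling v ≤ 1
      by-cases (yes refl) = ℕ.≤-reflexive (trans (removeOne-self m ceiling) (cong (_∸ 1) ceiling-m))
      by-cases (no v≢m)   = ℕ.≤-trans (ℕ.≤-reflexive (removeOne-other ceiling v≢m)) (ceiling-≤1 v v≢m)

  -- The emptied vertex u blocks the path from m to r₀.
  ceiling-critical-spine : ∀ {u} → u ≢ r₀ → u ≢ hub → u ≢ m → ¬ Solvable G r₀ (removeOne G u ceiling)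
  ceiling-critical-spine {u} u≢r₀ u≢hub u≢m = blocked-unsolvable (s≤s z≤n) (after (u≢r₀ ∘ sym) ceiling-r₀)
    (after (u≢hub ∘ sym) ceiling-hub , m ,
     ℕ.≤-reflexive (sym (after (u≢m ∘ sym) ceiling-m)) ,
     ℕ.≤-trans (ℕ.≤-reflexive (after (u≢m ∘ sym) ceiling-m)) (ℕ.n≤1+n 2) ,
     (λ v v≢m → ℕ.≤-trans (removeOne-≤ u ceiling v) (ceiling-≤1 v v≢m)) ,
     u , inj₁ (0<u , u<m) , trans (removeOne-self u ceiling) (cong (_∸ 1) (ceiling-spine u≢r₀ u≢hub u≢m)))
    where
    after : ∀ {v a} → v ≢ u → ceiling v ≡ a → removeOne G u ceiling v ≡ a
    after v≢u Dv≡a = trans (removeOne-other ceiling v≢u) Dv≡a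
    0<u : 0 < toℕ u
    0<u = ℕ.n≢0⇒n>0 (λ u≡0 → u≢r₀ (Fin.toℕ-injective (trans u≡0 (sym toℕ-r₀))))
    u<m : toℕ u < toℕ m
    u<m = subst (toℕ u <_) (sym toℕ-m)
      (ℕ.≤∧≢⇒< (ℕ.≤-pred (≢hub⇒spine u≢hub))
               (λ u≡j → u≢m (Fin.toℕ-injective (trans u≡j (sym toℕ-m)))))

  ceiling-critical : ∀ u → 1 ≤ ceiling u → ¬ Solvable G r₀ (removeOne G u ceiling)
  ceiling-critical u 1≤Du = by-cases (u ≟ m)
    where
    empty≢ : ∀ {v} → ceiling v ≡ 0 → u ≢ v
    empty≢ Dv≡0 refl with () ← subst (1 ≤_) Dv≡0 1≤Du
    by-cases : Dec (u ≡ m) → ¬ Solvable G r₀ (removeOne G u ceiling)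
    by-cases (yes refl) = ceiling-critical-m
    by-cases (no u≢m)   = ceiling-critical-spine (empty≢ ceiling-r₀) (empty≢ ceiling-hub) u≢m

  ceiling-size : Σℕ.sum ceiling ≡ suc j
  ceiling-size = ℕ.+-cancelʳ-≡ 1 _ _ (trans (ℕ.+-cancelʳ-≡ 1 _ _ two-more) (ℕ.+-comm 1 (suc j)))
    where
    pointwise : ∀ v → ceiling v + (r₀ ↦ 1) v + (hub ↦ 1) v ≡ 1 + (m ↦ 1) v
    pointwise v = by-cases (v ≟ r₀) (v ≟ hub) (v ≟ m)
      where
      by-cases : Dec (v ≡ r₀) → Dec (v ≡ hub) → Dec (v ≡ m) →
                 ceiling v + (r₀ ↦ 1) v + (hub ↦ 1) v ≡ 1 + (m ↦ 1) v
      by-cases (yes refl) _ _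
        rewrite ceiling-r₀ | ↦-at r₀ 1 | ↦-off {x = hub} 1 r₀≢hub | ↦-off {x = m} 1 (m≢r₀ ∘ sym) = refl
      by-cases (no v≢r₀) (yes refl) _
        rewrite ceiling-hub | ↦-off {x = r₀} 1 v≢r₀ | ↦-at hub 1 | ↦-off {x = m} 1 (m≢hub ∘ sym) = refl
      by-cases (no v≢r₀) (no v≢hub) (yes refl)
        rewrite ceiling-m | ↦-off {x = r₀} 1 v≢r₀ | ↦-off {x = hub} 1 v≢hub | ↦-at m 1 = refl
      by-cases (no v≢r₀) (no v≢hub) (no v≢m)
        rewrite ceiling-spine v≢r₀ v≢hub v≢m
              | ↦-off {x = r₀} 1 v≢r₀ | ↦-off {x = hub} 1 v≢hub | ↦-off {x = m} 1 v≢m = refl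
    two-more : Σℕ.sum ceiling + 1 + 1 ≡ suc (suc j) + 1
    two-more = trans (sym (sum-+↦+↦ ceiling r₀ hub)) (trans (Σℕ.sum-cong-≗ pointwise) (sum-1+↦ m))

  dist-r₁ : dist G r₁ r₀ ≡ 1
  dist-r₁ = dist-adj (s≤s (s≤s z≤n)) r₁≢r₀
    (fanAdj⁺ (spine-spine 1<k (s≤s z≤n) (inj₂ (trans (cong suc toℕ-r₀) (sym toℕ-r₁)))))

  dist-far : ∀ {v} → v ≢ r₀ → v ≢ r₁ → v ≢ hub → dist G v r₀ ≡ 2
  dist-far {v} v≢r₀ v≢r₁ v≢hub =
    dist-common-neighbour {w = hub} (s≤s (s≤s (ℕ.≤-trans (s≤s z≤n) 3≤j))) v≢r₀ ¬vr₀
                          (adj-hub (≢hub⇒spine v≢hub)) (hub-adj (s≤s z≤n))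
    where
    ¬vr₀ : adj G v r₀ ≢ true
    ¬vr₀ vr₀ with fanAdj⁻ {v} {r₀} vr₀
    ... | hub-spine v≡k _ = v≢hub (toℕ≡k⇒hub v≡k)
    ... | spine-hub _ r₀≡k with () ← trans (sym toℕ-r₀) r₀≡k
    ... | spine-spine _ _ (inj₁ sv≡r₀) with () ← trans sv≡r₀ toℕ-r₀
    ... | spine-spine _ _ (inj₂ sr₀≡v) =
      v≢r₁ (Fin.toℕ-injective (trans (sym sr₀≡v) (trans (cong suc toℕ-r₀) (sym toℕ-r₁))))

  ceiling-weight : weight G r₀ ceiling ≡ + (suc j + 1) / 4
  ceiling-weight = begin
    weight G r₀ ceiling                              ≡⟨ weight≡sum G r₀ ceiling ⟩
    Σℚ.sum (λ v → ceiling v /2^ dist G v r₀)         ≡⟨ Σℚ.sum-cong-≗ share ⟩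
    Σℚ.sum (λ v → + (ceiling v + (r₁ ↦ 1) v) / 4)    ≡⟨ sum-/ (λ v → ceiling v + (r₁ ↦ 1) v) 4 ⟩
    + Σℕ.sum (λ v → ceiling v + (r₁ ↦ 1) v) / 4      ≡⟨ cong (λ s → + s / 4) total ⟩
    + (suc j + 1) / 4                                ∎
    where
    open ≡-Reasoning
    total : Σℕ.sum (λ v → ceiling v + (r₁ ↦ 1) v) ≡ suc j + 1
    total = trans (Σℕ.∑-distrib-+ ceiling (r₁ ↦ 1)) (cong₂ _+_ ceiling-size (sum-↦ r₁ 1))
    numerators : ∀ v → ceiling v * 4 ≡ (ceiling v + (r₁ ↦ 1) v) * 2 ^ dist G v r₀
    numerators v = by-cases (v ≟ r₀) (v ≟ hub) (v ≟ r₁) (v ≟ m)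
      where
      by-cases : Dec (v ≡ r₀) → Dec (v ≡ hub) → Dec (v ≡ r₁) → Dec (v ≡ m) →
                 ceiling v * 4 ≡ (ceiling v + (r₁ ↦ 1) v) * 2 ^ dist G v r₀
      by-cases (yes refl) _ _ _ rewrite ceiling-r₀ | ↦-off {x = r₁} 1 (r₁≢r₀ ∘ sym) = refl
      by-cases (no _) (yes refl) _ _ rewrite ceiling-hub | ↦-off {x = r₁} 1 (r₁≢hub ∘ sym) = refl
      by-cases (no _) (no _) (yes refl) _
        rewrite ceiling-spine r₁≢r₀ r₁≢hub (m≢r₁ ∘ sym) | ↦-at r₁ 1 | dist-r₁ = refl
      by-cases (no v≢r₀) (no v≢hub) (no v≢r₁) (yes refl)
        rewrite ceiling-m | ↦-off {x = r₁} 1 v≢r₁ | dist-far v≢r₀ v≢r₁ v≢hub = refl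
      by-cases (no v≢r₀) (no v≢hub) (no v≢r₁) (no v≢m)
        rewrite ceiling-spine v≢r₀ v≢hub v≢m | ↦-off {x = r₁} 1 v≢r₁ | dist-far v≢r₀ v≢r₁ v≢hub = refl
    share : ∀ v → ceiling v /2^ dist G v r₀ ≡ + (ceiling v + (r₁ ↦ 1) v) / 4
    share v = cross-≡⇒/≡/ (ceiling v) (ceiling v + (r₁ ↦ 1) v) (2 ^ dist G v r₀) 4 {{ℕ.m^n≢0 2 (dist G v r₀)}}
                          (numerators v)

theorem26 : (k : ℕ) → 4 ≤ k →
    Σ ℕ λ c → IsCr (fan k) c × IsW (fan k) c ((+ (k + 1)) / 4)
theorem26 (suc j) 4≤k@(s≤s 3≤j) =
  suc j , ((r₀ , ceiling , ceiling-is-critical , ceiling-has-size) , size-bound) ,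
          ((r₀ , ceiling , (ceiling-is-critical , ceiling-has-size) , ceiling-weight) , weight-bound)
  where
  open Fan (suc j)
  open CeilingDistribution j 3≤j
  ceiling-is-critical : Critical G r₀ ceiling
  ceiling-is-critical = ceiling-solvable , ceiling-critical
  ceiling-has-size : size G ceiling ≡ suc j
  ceiling-has-size = trans (size≡sum G ceiling) ceiling-size
  size-bound : ∀ r D → Critical G r D → size G D ≤ suc j
  size-bound r D (solvable , critical) rewrite size≡sum G D with Classify.classify 4≤k solvable critical
  ... | tiny ≤3     = ℕ.≤-trans ≤3 (ℕ.≤-trans (ℕ.n≤1+n 3) 4≤k)
  ... | sparse ≤k _ = ≤k
  weight-bound : ∀ r D → Ceiling G (suc j) r D → weight G r D ℚ.≤ + (suc j + 1) / 4
  weight-bound r D ((solvable , critical) , size≡k) with Classify.classify 4≤k solvable critical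
  ... | tiny ≤3 with s≤s (s≤s (s≤s ())) ←
    ℕ.≤-trans 4≤k (subst (_≤ 3) (trans (sym (size≡sum G D)) size≡k) ≤3)
  ... | sparse _ sparse-around =
    subst (λ s → weight G r D ℚ.≤ + (s + 1) / 4) size≡k (weight-≤ (s≤s (s≤s z≤n)) sparse-around)
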